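{- Let $S$ be a solid and let $a,b\in S$ be precise, i.e. $e(a)=e(b)=0$. Then $a+b$, $-b$ and $ab$ are precise. If moreover $a\ne 0$, then $u(a)$ and $a^{ -1}$ are also precise.
   Context: A solid is a set $S$ with binary operations $+$ and $\cdot$ and a relation $\le$ satisfying: (1) $+$ is associative and commutative; for every $x$ there is a unique $e$ with $x+e=x$ and $e+f=e$ whenever $x+f=x$, written $e(x)$ (the magnitude of $x$); for every $x$ there is $s$ with $x+s=e(x)$ and $e(s)=e(x)$, written $-x$; $e(x+y)=e(x)$ or $e(x+y)=e(y)$. (2) $\cdot$ is associative and commutative; for every $x\ne e(x)$ there is a unique $u$ with $xu=x$ and $uv=u$ whenever $xv=x$, written $u(x)$; for every $x\ne e(x)$ there is $d$ with $xd=u(x)$ and $u(d)=u(x)$, written $x^{ -1}$; for $x\ne e(x),y\ne e(y)$: $u(xy)=u(x)$ or $u(xy)=u(y)$. (3) $\le$ is a total order; $x\le y\Rightarrow x+z\le y+z$; $y+e(x)=e(x)\Rightarrow (y\le e(x)$ and $-y\le e(x))$; $(e(x)<x$ and $y\le z)\Rightarrow xy\le xz$; $e(y)\le y\le z\Rightarrow e(x)y\le e(x)z$. (4) For all $x,y$ there is $z$ with $e(x)y=e(z)$; $e(xy)=e(x)y+e(y)x$; for $x\ne e(x)$, $e(u(x))=e(x)x^{ -1}$; $xy+xz=x(y+z)+e(x)y+e(x)z$; $-(xy)=(-x)y$. (5) There is $0$ with $0+x=x$ for all $x$ (it is unique, called zero); there is $1$ with $1x=x$ for all $x$; there is $M$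 with $e(x)+M=M$ for all $x$; there is $x$ with $e(x)\ne 0$ and $e(x)\ne M$; for every $x$ there is $a$ with $x=a+e(x)$ and $e(a)=0$; if $x=e(x)$, $y=e(y)$ and $x<y$ then there is $z\ne e(z)$ with $x<z<y$. An element $x$ is precise if $e(x)=0$. -}

module Defs where

open import Level using (Level; _⊔_; suc)
open import Data.Product using (Σ; ∃; _×_; _,_)
open import Data.Sum using (_⊎_)
open import Relation.Nullary using (¬_)
open import Relation.Binary.Core using (Rel)
open import Relation.Binary.Structures using (IsTotalOrder)
open import Relation.Binary.PropositionalEquality using (_≡_; _≢_)

-- The derived operations e (magnitude), u (unity), - (opposite) and ⁻¹ (inverse)
-- are given as fields together with their defining properties.  Uniqueness of
-- e(x) and u(x) follows from the stated minimality properties.  u and ⁻¹ are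
-- total functions whose axioms only constrain them at x ≢ e x.
record Solid (c ℓ : Level) : Set (Level.suc (c ⊔ ℓ)) where
  infixl 6 _+_
  infixl 7 _·_
  infix 4 _≤_ _<_
  field
    Carrier : Set c
    _+_ _·_ : Carrier → Carrier → Carrier
    _≤_     : Rel Carrier ℓ
    e u neg inv : Carrier → Carrier
    0# 1# M : Carrier

  _<_ : Carrier → Carrier → Set (c ⊔ ℓ)
  x < y = x ≤ y × x ≢ y

  field
    +-assoc : ∀ x y z → (x + y) + z ≡ x + (y + z)
    +-comm  : ∀ x y → x + y ≡ y + x
    e-neutral : ∀ x → x + e x ≡ x
    e-minimal : ∀ x f → x + f ≡ x → e x + f ≡ e x
    neg-inverse : ∀ x → x + neg x ≡ e x
    neg-magnitude : ∀ x → e (neg x) ≡ e x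
    e-+ : ∀ x y → e (x + y) ≡ e x ⊎ e (x + y) ≡ e y
    ·-assoc : ∀ x y z → (x · y) · z ≡ x · (y · z)
    ·-comm  : ∀ x y → x · y ≡ y · x
    u-neutral : ∀ x → x ≢ e x → x · u x ≡ x
    u-minimal : ∀ x → x ≢ e x → ∀ v → x · v ≡ x → u x · v ≡ u x
    inv-inverse : ∀ x → x ≢ e x → x · inv x ≡ u x
    inv-unity : ∀ x → x ≢ e x → u (inv x) ≡ u x
    u-· : ∀ x y → x ≢ e x → y ≢ e y → u (x · y) ≡ u x ⊎ u (x · y) ≡ u y
    ≤-isTotalOrder : IsTotalOrder _≡_ _≤_
    ≤-+ : ∀ x y z → x ≤ y → x + z ≤ y + z
    ≤-e : ∀ x y → y + e x ≡ e x → (y ≤ e x × neg y ≤ e x)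
    ≤-·-pos : ∀ x y z → e x < x → y ≤ z → x · y ≤ x · z
    ≤-·-e : ∀ x y z → e y ≤ y → y ≤ z → e x · y ≤ e x · z
    e-·-magnitude : ∀ x y → ∃ λ z → e x · y ≡ e z
    e-· : ∀ x y → e (x · y) ≡ e x · y + e y · x
    e-u : ∀ x → x ≢ e x → e (u x) ≡ e x · inv x
    distrib : ∀ x y z → x · y + x · z ≡ x · (y + z) + e x · y + e x · z
    neg-· : ∀ x y → neg (x · y) ≡ neg x · y
    +-identity : ∀ x → 0# + x ≡ x
    ·-identity : ∀ x → 1# · x ≡ x
    M-max : ∀ x → e x + M ≡ M
    nontrivial : ∃ λ x → e x ≢ 0# × e x ≢ M
    precise-part : ∀ x → ∃ λ a → x ≡ a + e x × e a ≡ 0#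
    dense : ∀ x y → x ≡ e x → y ≡ e y → x < y →
            ∃ λ z → z ≢ e z × x < z × z < y

  Precise : Carrier → Set c
  Precise x = e x ≡ 0#

module Submission where

open import Defs
open import Level using (Level)
open import Data.Product using (_×_; _,_; proj₁)
open import Data.Sum using (inj₁; inj₂)
open import Data.Empty using (⊥-elim)
open import Relation.Nullary using (¬_)
open import Relation.Binary.Structures using (IsTotalOrder)
open import Relation.Binary.PropositionalEquality
  using (_≡_; _≢_; sym; trans; cong; cong₂; subst; subst₂; module ≡-Reasoning)

-- The crux is that the unit is precise, e(1) = 0.  Write 1 = a + e(1) with a
-- precise; a ≠ 0 since otherwise every x = 1·x = e(1)·x would be a magnitude.
-- Distributivity gives e(1)² = e(1) + e(1)², and the order axioms give
-- e(1)² ≤ 0 ≤ e(1)² (comparing e(1) with ±a), so e(1) = e(1)² = 0.  Hence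
-- 0·b = e(1)·b = 0 for precise b, and e(ab) = e(a)b + e(b)a vanishes.  For
-- a ≠ 0 precise, e(ay) = 0·y + e(y)a is a sum of nonnegative terms, so
-- e(ay) = 0 forces e(y)a = 0; with y = u(a) and y = a⁻¹ this kills both
-- magnitudes.

module SolidProperties {c ℓ : Level} (S : Solid c ℓ) where
  open Solid S
  open IsTotalOrder ≤-isTotalOrder using (antisym; total) renaming (refl to ≤-refl; trans to ≤-trans)
  open ≡-Reasoning

  +-identityʳ : ∀ x → x + 0# ≡ x
  +-identityʳ x = trans (+-comm x 0#) (+-identity x)

  ·-identityʳ : ∀ x → x · 1# ≡ x
  ·-identityʳ x = trans (·-comm x 1#) (·-identity x)

  e[x]+e[x]≡e[x] : ∀ x → e x + e x ≡ e x
  e[x]+e[x]≡e[x] x = e-minimal x (e x) (e-neutral x)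

  e-idem : ∀ x → e (e x) ≡ e x
  e-idem x = begin
    e (e x)         ≡⟨ sym (e-minimal (e x) (e x) (e[x]+e[x]≡e[x] x)) ⟩
    e (e x) + e x   ≡⟨ +-comm _ _ ⟩
    e x + e (e x)   ≡⟨ e-neutral (e x) ⟩
    e x             ∎

  x≡e[z]⇒x≡e[x] : ∀ {x z} → x ≡ e z → x ≡ e x
  x≡e[z]⇒x≡e[x] {z = z} x≡e[z] = trans x≡e[z] (sym (trans (cong e x≡e[z]) (e-idem z)))

  Precise-0 : Precise 0#
  Precise-0 = trans (sym (+-identity (e 0#))) (e-neutral 0#)

  Precise-neg : ∀ {x} → Precise x → Precise (neg x)
  Precise-neg {x} px = trans (neg-magnitude x) px

  Precise-+ : ∀ {x y} → Precise x → Precise y → Precise (x + y)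
  Precise-+ {x} {y} px py with e-+ x y
  ... | inj₁ q = trans q px
  ... | inj₂ q = trans q py

  0≤e[x] : ∀ x → 0# ≤ e x
  0≤e[x] x = proj₁ (≤-e x 0# (+-identity (e x)))

  0≤e[x]·y : ∀ x y → 0# ≤ e x · y
  0≤e[x]·y x y with e-·-magnitude x y
  ... | z , eq = subst (0# ≤_) (sym eq) (0≤e[x] z)

  0≤0·y : ∀ y → 0# ≤ 0# · y
  0≤0·y y = subst (λ t → 0# ≤ t · y) Precise-0 (0≤e[x]·y 0# y)

  0≤x⇒0≤y⇒x+y≡0⇒y≡0 : ∀ x y → 0# ≤ x → 0# ≤ y → x + y ≡ 0# → y ≡ 0#
  0≤x⇒0≤y⇒x+y≡0⇒y≡0 x y 0≤x 0≤y x+y≡0 = antisym y≤0 0≤y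
    where
      y≤0 : y ≤ 0#
      y≤0 = subst₂ _≤_ (+-identity y) x+y≡0 (≤-+ 0# x y 0≤x)

  x≤0⇒0≤neg[x] : ∀ {x} → Precise x → x ≤ 0# → 0# ≤ neg x
  x≤0⇒0≤neg[x] {x} px x≤0 =
    subst₂ _≤_ (trans (neg-inverse x) px) (+-identity (neg x)) (≤-+ x 0# (neg x) x≤0)

  neg[x]≡0⇒x≡0 : ∀ {x} → Precise x → neg x ≡ 0# → x ≡ 0#
  neg[x]≡0⇒x≡0 {x} px nx≡0 = begin
    x          ≡⟨ sym (+-identityʳ x) ⟩
    x + 0#     ≡⟨ cong (x +_) (sym nx≡0) ⟩
    x + neg x  ≡⟨ neg-inverse x ⟩
    e x        ≡⟨ px ⟩
    0#         ∎

  Precise[x+e[z]]⇒Precise[z] : ∀ x z → Precise (x + e z) → Precise z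
  Precise[x+e[z]]⇒Precise[z] x z p =
    trans (sym (+-identity (e z))) (subst (λ t → t + e z ≡ t) p absorbs)
    where
      absorbs : e (x + e z) + e z ≡ e (x + e z)
      absorbs = e-minimal (x + e z) (e z)
        (trans (+-assoc x (e z) (e z)) (cong (x +_) (e[x]+e[x]≡e[x] z)))

  Precise⇒e[1]·x≡0 : ∀ {x} → Precise x → e 1# · x ≡ 0#
  Precise⇒e[1]·x≡0 {x} px = sym (begin
    0#                   ≡⟨ sym px ⟩
    e x                  ≡⟨ cong e (sym (·-identity x)) ⟩
    e (1# · x)           ≡⟨ e-· 1# x ⟩
    e 1# · x + e x · 1#  ≡⟨ cong (e 1# · x +_) (trans (·-identityʳ (e x)) px) ⟩
    e 1# · x + 0#        ≡⟨ +-identityʳ _ ⟩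
    e 1# · x             ∎)

  ¬all-magnitudes : ¬ (∀ x → x ≡ e x)
  ¬all-magnitudes all-e with nontrivial
  ... | x , e[x]≢0 , _
    with dense 0# (e x) (sym Precise-0) (sym (e-idem x)) (0≤e[x] x , λ q → e[x]≢0 (sym q))
  ... | z , z≢e[z] , _ = z≢e[z] (all-e z)

  Precise⇒x≢0⇒x·x≢0 : ∀ {x} → Precise x → x ≢ 0# → x · x ≢ 0#
  Precise⇒x≢0⇒x·x≢0 {x} px x≢0 x·x≡0 = x≢0 (trans x≡e[x] px)
    where
      x≢e[x] : x ≢ e x
      x≢e[x] q = x≢0 (trans q px)
      x≡e[0]·x⁻¹ : x ≡ e 0# · inv x
      x≡e[0]·x⁻¹ = begin
        x                ≡⟨ sym (u-neutral x x≢e[x]) ⟩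
        x · u x          ≡⟨ cong (x ·_) (sym (inv-inverse x x≢e[x])) ⟩
        x · (x · inv x)  ≡⟨ sym (·-assoc x x (inv x)) ⟩
        (x · x) · inv x  ≡⟨ cong (_· inv x) (trans x·x≡0 (sym Precise-0)) ⟩
        e 0# · inv x     ∎
      x≡e[x] : x ≡ e x
      x≡e[x] with e-·-magnitude 0# (inv x)
      ... | z , eq = x≡e[z]⇒x≡e[x] (trans x≡e[0]·x⁻¹ eq)

  -- x ≤ e(1) is impossible: it would give 0 ≤ x·0 ≤ x·x ≤ x·e(1) = 0.
  Precise⇒0≤x⇒x≢0⇒e[1]·e[1]≤0 : ∀ {x} → Precise x → 0# ≤ x → x ≢ 0# → e 1# · e 1# ≤ 0#
  Precise⇒0≤x⇒x≢0⇒e[1]·e[1]≤0 {x} px 0≤x x≢0 with total (e 1#) x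
  ... | inj₁ e[1]≤x = subst (e 1# · e 1# ≤_) (Precise⇒e[1]·x≡0 px)
        (≤-·-e 1# (e 1#) x (subst (_≤ e 1#) (sym (e-idem 1#)) ≤-refl) e[1]≤x)
  ... | inj₂ x≤e[1] = ⊥-elim (Precise⇒x≢0⇒x·x≢0 px x≢0 (antisym x·x≤0 0≤x·x))
    where
      e[x]<x : e x < x
      e[x]<x = subst (_≤ x) (sym px) 0≤x , λ q → x≢0 (trans (sym q) px)
      x·x≤0 : x · x ≤ 0#
      x·x≤0 = subst (x · x ≤_) (trans (·-comm x (e 1#)) (Precise⇒e[1]·x≡0 px))
        (≤-·-pos x x (e 1#) e[x]<x x≤e[1])
      0≤x·x : 0# ≤ x · x
      0≤x·x = ≤-trans (subst (0# ≤_) (·-comm 0# x) (0≤0·y x)) (≤-·-pos x 0# x e[x]<x 0≤x)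

  Precise⇒x≢0⇒e[1]·e[1]≤0 : ∀ {x} → Precise x → x ≢ 0# → e 1# · e 1# ≤ 0#
  Precise⇒x≢0⇒e[1]·e[1]≤0 {x} px x≢0 with total 0# x
  ... | inj₁ 0≤x = Precise⇒0≤x⇒x≢0⇒e[1]·e[1]≤0 px 0≤x x≢0
  ... | inj₂ x≤0 = Precise⇒0≤x⇒x≢0⇒e[1]·e[1]≤0 (Precise-neg px) (x≤0⇒0≤neg[x] px x≤0)
                     (λ q → x≢0 (neg[x]≡0⇒x≡0 px q))

  Precise-1 : Precise 1#
  Precise-1 with precise-part 1#
  ... | a , 1≡a+e[1] , pa = begin
    e 1#       ≡⟨ sym (+-identityʳ (e 1#)) ⟩
    e 1# + 0#  ≡⟨ cong (e 1# +_) (sym m≡0) ⟩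
    e 1# + m   ≡⟨ sym m≡e[1]+m ⟩
    m          ≡⟨ m≡0 ⟩
    0#         ∎
    where
      m = e 1# · e 1#
      m≡e[1]+m : m ≡ e 1# + m
      m≡e[1]+m = begin
        m                                          ≡⟨ sym (+-identity m) ⟩
        0# + m                                     ≡⟨ cong (_+ m) (sym (Precise⇒e[1]·x≡0 pa)) ⟩
        e 1# · a + m                               ≡⟨ distrib (e 1#) a (e 1#) ⟩
        e 1# · (a + e 1#) + e (e 1#) · a + e (e 1#) · e 1#
          ≡⟨ cong₂ (λ s t → e 1# · s + t · a + t · e 1#) (sym 1≡a+e[1]) (e-idem 1#) ⟩
        e 1# · 1# + e 1# · a + m                   ≡⟨ cong₂ (λ s t → s + t + m) (·-identityʳ (e 1#)) (Precise⇒e[1]·x≡0 pa) ⟩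
        e 1# + 0# + m                              ≡⟨ cong (_+ m) (+-identityʳ (e 1#)) ⟩
        e 1# + m                                   ∎
      a≢0 : a ≢ 0#
      a≢0 a≡0 = ¬all-magnitudes all-e
        where
          1≡e[1] : 1# ≡ e 1#
          1≡e[1] = trans 1≡a+e[1] (trans (cong (_+ e 1#) a≡0) (+-identity (e 1#)))
          all-e : ∀ x → x ≡ e x
          all-e x with e-·-magnitude 1# x
          ... | z , eq = x≡e[z]⇒x≡e[x] (trans (sym (·-identity x)) (trans (cong (_· x) 1≡e[1]) eq))
      m≡0 : m ≡ 0#
      m≡0 = antisym (Precise⇒x≢0⇒e[1]·e[1]≤0 pa a≢0) (0≤e[x]·y 1# (e 1#))

  Precise⇒0·x≡0 : ∀ {x} → Precise x → 0# · x ≡ 0#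
  Precise⇒0·x≡0 {x} px = trans (cong (_· x) (sym Precise-1)) (Precise⇒e[1]·x≡0 px)

  Precise-· : ∀ {x y} → Precise x → Precise y → Precise (x · y)
  Precise-· {x} {y} px py = begin
    e (x · y)            ≡⟨ e-· x y ⟩
    e x · y + e y · x    ≡⟨ cong₂ (λ s t → s · y + t · x) px py ⟩
    0# · y + 0# · x      ≡⟨ cong₂ _+_ (Precise⇒0·x≡0 py) (Precise⇒0·x≡0 px) ⟩
    0# + 0#              ≡⟨ +-identity 0# ⟩
    0#                   ∎

  Precise⇒Precise[x·y]⇒e[y]·x≡0 : ∀ {x} y → Precise x → Precise (x · y) → e y · x ≡ 0#
  Precise⇒Precise[x·y]⇒e[y]·x≡0 {x} y px pxy =
    0≤x⇒0≤y⇒x+y≡0⇒y≡0 (0# · y) (e y · x) (0≤0·y y) (0≤e[x]·y y x) (begin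
      0# · y + e y · x   ≡⟨ cong (λ t → t · y + e y · x) (sym px) ⟩
      e x · y + e y · x  ≡⟨ sym (e-· x y) ⟩
      e (x · y)          ≡⟨ pxy ⟩
      0#                 ∎)

  module _ {a : Carrier} (pa : Precise a) (a≢0 : a ≢ 0#) where

    a≢e[a] : a ≢ e a
    a≢e[a] q = a≢0 (trans q pa)

    e[u[a]]≡0·a⁻¹ : e (u a) ≡ 0# · inv a
    e[u[a]]≡0·a⁻¹ = trans (e-u a a≢e[a]) (cong (_· inv a) pa)

    Precise-u : Precise (u a)
    Precise-u with precise-part (u a)
    ... | p , u[a]≡p+n , pp =
      Precise[x+e[z]]⇒Precise[z] a (u a) (trans (cong e (sym a·p≡a+n)) (Precise-· pa pp))
      where
        n = e (u a)
        a·n≡0 : a · n ≡ 0#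
        a·n≡0 = trans (·-comm a n)
          (Precise⇒Precise[x·y]⇒e[y]·x≡0 (u a) pa (trans (cong e (u-neutral a a≢e[a])) pa))
        0·n≡n : 0# · n ≡ n
        0·n≡n = begin
          0# · n              ≡⟨ cong (0# ·_) e[u[a]]≡0·a⁻¹ ⟩
          0# · (0# · inv a)   ≡⟨ sym (·-assoc 0# 0# (inv a)) ⟩
          (0# · 0#) · inv a   ≡⟨ cong (_· inv a) (Precise⇒0·x≡0 Precise-0) ⟩
          0# · inv a          ≡⟨ sym e[u[a]]≡0·a⁻¹ ⟩
          n                   ∎
        a·p≡a+n : a · p ≡ a + n
        a·p≡a+n = begin
          a · p                            ≡⟨ sym (+-identityʳ (a · p)) ⟩
          a · p + 0#                       ≡⟨ cong (a · p +_) (sym a·n≡0) ⟩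
          a · p + a · n                    ≡⟨ distrib a p n ⟩
          a · (p + n) + e a · p + e a · n  ≡⟨ cong₂ (λ s t → a · s + t · p + t · n) (sym u[a]≡p+n) pa ⟩
          a · u a + 0# · p + 0# · n        ≡⟨ cong₂ (λ s t → s + t + 0# · n) (u-neutral a a≢e[a]) (Precise⇒0·x≡0 pp) ⟩
          a + 0# + 0# · n                  ≡⟨ cong₂ _+_ (+-identityʳ a) 0·n≡n ⟩
          a + n                            ∎

    Precise-inv : Precise (inv a)
    Precise-inv = begin
      k                               ≡⟨ cong e (sym a⁻¹·u[a]≡a⁻¹) ⟩
      e (inv a · u a)                 ≡⟨ e-· (inv a) (u a) ⟩
      k · u a + e (u a) · inv a       ≡⟨ cong₂ _+_ k·u[a]≡0 (trans (cong (_· inv a) Precise-u) 0·a⁻¹≡0) ⟩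
      0# + 0#                         ≡⟨ +-identity 0# ⟩
      0#                              ∎
      where
        k = e (inv a)
        k·a≡0 : k · a ≡ 0#
        k·a≡0 = Precise⇒Precise[x·y]⇒e[y]·x≡0 (inv a) pa
          (trans (cong e (inv-inverse a a≢e[a])) Precise-u)
        0·a⁻¹≡0 : 0# · inv a ≡ 0#
        0·a⁻¹≡0 = trans (sym e[u[a]]≡0·a⁻¹) Precise-u
        u[a]≡0 : inv a ≡ k → u a ≡ 0#
        u[a]≡0 a⁻¹≡k = begin
          u a          ≡⟨ sym (inv-inverse a a≢e[a]) ⟩
          a · inv a    ≡⟨ cong (a ·_) a⁻¹≡k ⟩
          a · k        ≡⟨ ·-comm a k ⟩
          k · a        ≡⟨ k·a≡0 ⟩
          0#           ∎
        a⁻¹≢k : inv a ≢ k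
        a⁻¹≢k a⁻¹≡k = a≢0 (begin
          a          ≡⟨ sym (u-neutral a a≢e[a]) ⟩
          a · u a    ≡⟨ cong (a ·_) (u[a]≡0 a⁻¹≡k) ⟩
          a · 0#     ≡⟨ ·-comm a 0# ⟩
          0# · a     ≡⟨ Precise⇒0·x≡0 pa ⟩
          0#         ∎)
        a⁻¹·u[a]≡a⁻¹ : inv a · u a ≡ inv a
        a⁻¹·u[a]≡a⁻¹ = trans (cong (inv a ·_) (sym (inv-unity a a≢e[a]))) (u-neutral (inv a) a⁻¹≢k)
        k·u[a]≡0 : k · u a ≡ 0#
        k·u[a]≡0 = begin
          k · u a          ≡⟨ cong (k ·_) (sym (inv-inverse a a≢e[a])) ⟩
          k · (a · inv a)  ≡⟨ sym (·-assoc k a (inv a)) ⟩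
          (k · a) · inv a  ≡⟨ cong (_· inv a) k·a≡0 ⟩
          0# · inv a       ≡⟨ 0·a⁻¹≡0 ⟩
          0#               ∎

proposition3p6 : ∀ {c ℓ : Level} (S : Solid c ℓ) → let open Solid S in
    ∀ (a b : Carrier) → Precise a → Precise b →
    (Precise (a + b) × Precise (neg b) × Precise (a · b))
    × (a ≢ 0# → Precise (u a) × Precise (inv a))
proposition3p6 S a b pa pb =
  (Precise-+ pa pb , Precise-neg pb , Precise-· pa pb) , λ a≢0 → Precise-u pa a≢0 , Precise-inv pa a≢0
  where open SolidProperties S
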